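{- Let $0\le k\le k+p<n$, let $A=a_1\cdots a_n$ be a binary string with $k\le w(A)\le k+p+1$, let $A^\infty=a_1a_2\cdots$ be generated from $A$ by the symmetric shift register with parameters $k,p,n$, and let $w_r=a_{r+1}+\cdots+a_{r+n}-k$ for $r\ge0$. Suppose $a_{r+i}=0$ for $1\le i\le q$, where $r\ge0$ and $q\ge1$, and let $s=\min\{q,p+1-w_r\}$. Then: (a) $w_{r+i}=w_r+i$ for $0\le i\le s$, and $a_{r+n+i}=1$ for $1\le i\le s$; (b) if $s<q$, then $w_{r+i}=p+1$ for $s\le i\le q$, and $a_{r+n+i}=0$ for $s<i\le q$; (c) $w_{r+q}=w_r+s$ and $a_{r+n+1}\cdots a_{r+n+q}=1_s0_{q-s}$.
   Context: $w(A)$ is the number of 1's in $A$; $0_j$, $1_j$ denote $j$ consecutive 0's or 1's (empty if $j=0$). The symmetric shift register with parameters $k,p,n$ generates $A^\infty=a_1a_2\cdots$ from $A$ by: for $i\ge0$, $a_{n+i+1}=1-a_{i+1}$ if $k\le a_{i+2}+\cdots+a_{i+n}\le k+p$, and $a_{n+i+1}=a_{i+1}$ otherwise. -}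

module Defs where

open import Data.Nat using (ℕ; zero; suc; _+_; _≤ᵇ_)
open import Data.Bool using (Bool; true; false; not; if_then_else_; _∧_)
open import Data.Vec using (Vec; []; _∷_; _∷ʳ_)
open import Data.Integer using (ℤ; +_; _-_)

bit : Bool → ℕ
bit true = 1
bit false = 0

weight : ∀ {n} → Vec Bool n → ℕ
weight [] = 0
weight (x ∷ xs) = bit x + weight xs

-- one step of the symmetric shift register with parameters k, p:
-- the window a_{i+1} ... a_{i+n} becomes a_{i+2} ... a_{i+n+1}, where
-- a_{n+i+1} = 1 - a_{i+1} if k ≤ a_{i+2}+...+a_{i+n} ≤ k+p, else a_{i+1}.
step : (k p : ℕ) → ∀ {n} → Vec Bool n → Vec Bool n
step k p [] = []
step k p (x ∷ xs) =
  xs ∷ʳ (if (k ≤ᵇ weight xs) ∧ (weight xs ≤ᵇ k + p) then not x else x)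

-- window k p A i = a_{i+1} ... a_{i+n}
window : (k p : ℕ) → ∀ {n} → Vec Bool n → ℕ → Vec Bool n
window k p A zero = A
window k p A (suc i) = step k p (window k p A i)

-- seqA k p A m = a_m (as 0/1 natural number), for m ≥ 1; seqA k p A 0 = 0 is a dummy.
seqA : (k p : ℕ) → ∀ {n} → Vec Bool n → ℕ → ℕ
seqA k p {zero} A m = 0
seqA k p {suc n} A zero = 0
seqA k p {suc n} A (suc i) with window k p A i
... | x ∷ _ = bit x

sumFrom : (ℕ → ℕ) → ℕ → ℕ → ℕ
sumFrom f r zero = 0
sumFrom f r (suc m) = sumFrom f r m + f (r + suc m)

wr : (k p n : ℕ) → Vec Bool n → ℕ → ℤ
wr k p n A r = + sumFrom (seqA k p A) r n - + k

-- While the current window a_{i+1} ... a_{i+n} starts with a 0, its other n - 1 bits weigh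
-- k + w_i, so the register appends a 1 exactly when w_i ≤ p: the excess w_i grows by one per
-- step until it reaches p + 1 and then stays there while 0's are appended.  Over a run of q zeros
-- this gives w_{r+i} = w_r + min(i, p + 1 - w_r), from which all three parts are read off; the
-- register preserves k ≤ weight ≤ k + p + 1, so 0 ≤ w_r ≤ p + 1 throughout.
module Submission where

open import Defs
open import Data.Nat using (ℕ; _+_; _≤_; _<_)
open import Data.Bool using (Bool)
open import Data.Vec using (Vec)
open import Data.Integer using (ℤ; +_; _-_; _⊓_) renaming (_≤_ to _≤ℤ_; _<_ to _<ℤ_; _+_ to _+ℤ_)
open import Data.Product using (_×_)
open import Relation.Binary.PropositionalEquality using (_≡_)

open import Function using (_∘_)
open import Data.Empty using (⊥-elim)
open import Data.Sum using (inj₁; inj₂)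
open import Data.Nat as ℕ using (zero; suc; _∸_; _≤ᵇ_; _<ᵇ_; z≤n; s≤s; z<s; s<s; s≤s⁻¹; s<s⁻¹)
open import Data.Nat.Properties
open import Data.Bool using (true; false; not; _∧_; if_then_else_)
open import Data.Vec using ([]; _∷_; _∷ʳ_; head; tail)
open import Data.Integer.Properties using ([+m]-[+n]≡m⊖n; ⊖-≥; drop‿+≤+; drop‿+<+)
open import Data.Product using (_,_; proj₁; proj₂)
open import Relation.Nullary.Reflects using (ofʸ)
open import Relation.Binary.PropositionalEquality using (refl; sym; trans; cong; cong₂; subst; subst₂; module ≡-Reasoning)
open ≡-Reasoning

bit≤1 : ∀ b → bit b ≤ 1
bit≤1 true  = ≤-refl
bit≤1 false = z≤n

bit≡0⇒false : ∀ {b} → bit b ≡ 0 → b ≡ false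
bit≡0⇒false {false} _ = refl

if-then-true-else-false : ∀ b → (if b then true else false) ≡ b
if-then-true-else-false true  = refl
if-then-true-else-false false = refl

1+m≤ᵇ1+n≡m≤ᵇn : ∀ m n → (suc m ≤ᵇ suc n) ≡ (m ≤ᵇ n)
1+m≤ᵇ1+n≡m≤ᵇn zero    n = refl
1+m≤ᵇ1+n≡m≤ᵇn (suc m) n = refl

+-cancelˡ-≤ᵇ : ∀ k m n → (k + m ≤ᵇ k + n) ≡ (m ≤ᵇ n)
+-cancelˡ-≤ᵇ zero    m n = refl
+-cancelˡ-≤ᵇ (suc k) m n = trans (1+m≤ᵇ1+n≡m≤ᵇn (k + m) (k + n)) (+-cancelˡ-≤ᵇ k m n)

m≤ᵇm+n : ∀ m n → (m ≤ᵇ m + n) ≡ true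
m≤ᵇm+n zero    n = refl
m≤ᵇm+n (suc m) n = trans (1+m≤ᵇ1+n≡m≤ᵇn m (m + n)) (m≤ᵇm+n m n)

m<n⇒bit[m<ᵇn]≡1 : ∀ {m n} → m < n → bit (m <ᵇ n) ≡ 1
m<n⇒bit[m<ᵇn]≡1 {zero}  {suc n} _         = refl
m<n⇒bit[m<ᵇn]≡1 {suc m} {suc n} (s≤s m<n) = m<n⇒bit[m<ᵇn]≡1 m<n

n≤m⇒bit[m<ᵇn]≡0 : ∀ {m n} → n ≤ m → bit (m <ᵇ n) ≡ 0
n≤m⇒bit[m<ᵇn]≡0 z≤n       = refl
n≤m⇒bit[m<ᵇn]≡0 (s≤s n≤m) = n≤m⇒bit[m<ᵇn]≡0 n≤m

m⊓n<ᵇn≡m<ᵇn : ∀ m n → (m ℕ.⊓ n <ᵇ n) ≡ (m <ᵇ n)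
m⊓n<ᵇn≡m<ᵇn zero    n       = refl
m⊓n<ᵇn≡m<ᵇn (suc m) zero    = refl
m⊓n<ᵇn≡m<ᵇn (suc m) (suc n) = m⊓n<ᵇn≡m<ᵇn m n

m⊓n+bit[m<ᵇn]≡[1+m]⊓n : ∀ m n → m ℕ.⊓ n + bit (m <ᵇ n) ≡ suc m ℕ.⊓ n
m⊓n+bit[m<ᵇn]≡[1+m]⊓n zero    zero    = refl
m⊓n+bit[m<ᵇn]≡[1+m]⊓n zero    (suc n) = refl
m⊓n+bit[m<ᵇn]≡[1+m]⊓n (suc m) zero    = refl
m⊓n+bit[m<ᵇn]≡[1+m]⊓n (suc m) (suc n) = cong suc (m⊓n+bit[m<ᵇn]≡[1+m]⊓n m n)

m⊓n<m⇒m⊓n≡n : ∀ {m n} → m ℕ.⊓ n < m → m ℕ.⊓ n ≡ n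
m⊓n<m⇒m⊓n≡n {m} {n} m⊓n<m with ⊓-sel m n
... | inj₁ m⊓n≡m = ⊥-elim (<-irrefl m⊓n≡m m⊓n<m)
... | inj₂ m⊓n≡n = m⊓n≡n

[+m]-[+n]≡+[m∸n] : ∀ {m n} → n ≤ m → + m - + n ≡ + (m ∸ n)
[+m]-[+n]≡+[m∸n] {m} {n} n≤m = trans ([+m]-[+n]≡m⊖n m n) (⊖-≥ n≤m)

sumFrom-head : ∀ f r m → sumFrom f r (suc m) ≡ f (suc r) + sumFrom f (suc r) m
sumFrom-head f r zero    = trans (cong f (+-comm r 1)) (sym (+-identityʳ _))
sumFrom-head f r (suc m) = begin
  sumFrom f r (suc m) + f (r + suc (suc m))           ≡⟨ cong₂ _+_ (sumFrom-head f r m) (cong f (+-suc r (suc m))) ⟩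
  f (suc r) + sumFrom f (suc r) m + f (suc r + suc m) ≡⟨ +-assoc (f (suc r)) _ _ ⟩
  f (suc r) + sumFrom f (suc r) (suc m)               ∎

-- Out-of-range indices read false; every use below is in range.
get : ∀ {n} → Vec Bool n → ℕ → Bool
get []       _       = false
get (x ∷ xs) zero    = x
get (x ∷ xs) (suc i) = get xs i

get-zero : ∀ {m} (v : Vec Bool (suc m)) → get v 0 ≡ head v
get-zero (x ∷ xs) = refl

get-∷ʳ-< : ∀ {m} (xs : Vec Bool m) b {i} → i < m → get (xs ∷ʳ b) i ≡ get xs i
get-∷ʳ-< (x ∷ xs) b {zero}  _   = refl
get-∷ʳ-< (x ∷ xs) b {suc i} i<m = get-∷ʳ-< xs b (s<s⁻¹ i<m)

get-∷ʳ-last : ∀ {m} (xs : Vec Bool m) b → get (xs ∷ʳ b) m ≡ b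
get-∷ʳ-last []       b = refl
get-∷ʳ-last (x ∷ xs) b = get-∷ʳ-last xs b

weight-∷ʳ : ∀ {m} (xs : Vec Bool m) b → weight (xs ∷ʳ b) ≡ weight xs + bit b
weight-∷ʳ []       b = +-identityʳ (bit b)
weight-∷ʳ (x ∷ xs) b = trans (cong (_+_ (bit x)) (weight-∷ʳ xs b)) (sym (+-assoc (bit x) _ _))

weight-rotate : ∀ {m} (xs : Vec Bool m) x → weight (xs ∷ʳ x) ≡ weight (x ∷ xs)
weight-rotate xs x = trans (weight-∷ʳ xs x) (+-comm (weight xs) (bit x))

weight-tail : ∀ {m} (v : Vec Bool (suc m)) → head v ≡ false → weight (tail v) ≡ weight v
weight-tail (false ∷ xs) refl = refl

weight≡sumFrom : ∀ {n} (v : Vec Bool n) f r →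
  (∀ i → i < n → bit (get v i) ≡ f (suc (r + i))) → weight v ≡ sumFrom f r n
weight≡sumFrom []               f r _     = refl
weight≡sumFrom {suc n} (x ∷ xs) f r entry = begin
  bit x + weight xs                      ≡⟨ cong₂ _+_ (entry 0 z<s) (weight≡sumFrom xs f (suc r) entry′) ⟩
  f (suc (r + 0)) + sumFrom f (suc r) n  ≡⟨ cong (λ t → f (suc t) + sumFrom f (suc r) n) (+-identityʳ r) ⟩
  f (suc r) + sumFrom f (suc r) n        ≡⟨ sumFrom-head f r n ⟨
  sumFrom f r (suc n)                    ∎
  where
  entry′ : ∀ i → i < n → bit (get xs i) ≡ f (suc (suc r + i))
  entry′ i i<n = trans (entry (suc i) (s<s i<n)) (cong (f ∘ suc) (+-suc r i))

module _ (k p : ℕ) where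

  WeightInRange : ℕ → Set
  WeightInRange w = k ≤ w × w ≤ k + p + 1

  step-preserves-range : ∀ {m} (v : Vec Bool (suc m)) →
    WeightInRange (weight v) → WeightInRange (weight (step k p v))
  step-preserves-range (x ∷ xs) in-range
    with k ≤ᵇ weight xs | ≤ᵇ-reflects-≤ k (weight xs)
  ... | false | _ = subst WeightInRange (sym (weight-rotate xs x)) in-range
  ... | true  | ofʸ k≤w with weight xs ≤ᵇ k + p | ≤ᵇ-reflects-≤ (weight xs) (k + p)
  ...   | false | _        = subst WeightInRange (sym (weight-rotate xs x)) in-range
  ...   | true  | ofʸ w≤k+p = subst WeightInRange (sym (weight-∷ʳ xs (not x)))
                               (≤-trans k≤w (m≤m+n _ _) , +-mono-≤ w≤k+p (bit≤1 _))

  step-head-false : ∀ {m} (v : Vec Bool (suc m)) t → head v ≡ false → weight v ≡ k + t →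
    step k p v ≡ tail v ∷ʳ (t ≤ᵇ p)
  step-head-false (false ∷ xs) t refl weight≡ =
    cong (xs ∷ʳ_) (begin
      (if (k ≤ᵇ weight xs) ∧ (weight xs ≤ᵇ k + p) then true else false)
        ≡⟨ cong (λ w → if (k ≤ᵇ w) ∧ (w ≤ᵇ k + p) then true else false) weight≡ ⟩
      (if (k ≤ᵇ k + t) ∧ (k + t ≤ᵇ k + p) then true else false)
        ≡⟨ cong₂ (λ b c → if b ∧ c then true else false) (m≤ᵇm+n k t) (+-cancelˡ-≤ᵇ k t p) ⟩
      (if t ≤ᵇ p then true else false)
        ≡⟨ if-then-true-else-false (t ≤ᵇ p) ⟩
      (t ≤ᵇ p) ∎)

  get-step : ∀ {m} (v : Vec Bool (suc m)) {i} → i < m → get (step k p v) i ≡ get v (suc i)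
  get-step (x ∷ xs) i<m = get-∷ʳ-< xs _ i<m

  module Windows {m : ℕ} (A : Vec Bool (suc m)) where

    W : ℕ → Vec Bool (suc m)
    W = window k p A

    a : ℕ → ℕ
    a = seqA k p A

    window-preserves-range : WeightInRange (weight A) → ∀ j → WeightInRange (weight (W j))
    window-preserves-range in-range zero    = in-range
    window-preserves-range in-range (suc j) = step-preserves-range (W j) (window-preserves-range in-range j)

    window-+ : ∀ j i → W (j + i) ≡ window k p (W j) i
    window-+ j zero    = cong W (+-identityʳ j)
    window-+ j (suc i) = trans (cong W (+-suc j i)) (cong (step k p) (window-+ j i))

    seqA-suc : ∀ j → a (suc j) ≡ bit (head (W j))
    seqA-suc j with W j
    ... | x ∷ _ = refl

    get-window : ∀ j i → i < suc m → get (W j) i ≡ head (W (j + i))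
    get-window j zero    _       = trans (get-zero (W j)) (cong (head ∘ W) (sym (+-identityʳ j)))
    get-window j (suc i) 1+i<1+m = begin
      get (W j) (suc i)     ≡⟨ get-step (W j) (s<s⁻¹ 1+i<1+m) ⟨
      get (W (suc j)) i     ≡⟨ get-window (suc j) i (m<n⇒m<1+n (s<s⁻¹ 1+i<1+m)) ⟩
      head (W (suc j + i))  ≡⟨ cong (head ∘ W) (+-suc j i) ⟨
      head (W (j + suc i))  ∎

    seqA-+n : ∀ j → a (j + suc m) ≡ bit (get (W j) m)
    seqA-+n j = begin
      a (j + suc m)            ≡⟨ cong a (+-suc j m) ⟩
      a (suc (j + m))          ≡⟨ seqA-suc (j + m) ⟩
      bit (head (W (j + m)))   ≡⟨ cong bit (get-window j m (n<1+n m)) ⟨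
      bit (get (W j) m)        ∎

    weight-window : ∀ j → weight (W j) ≡ sumFrom a j (suc m)
    weight-window j = weight≡sumFrom (W j) a j
      (λ i i<n → trans (cong bit (get-window j i i<n)) (sym (seqA-suc (j + i))))

    wr-window : ∀ j t → weight (W j) ≡ k + t → wr k p (suc m) A j ≡ + t
    wr-window j t weight≡ = begin
      + sumFrom a j (suc m) - + k  ≡⟨ cong (λ w → + w - + k) (trans (sym (weight-window j)) weight≡) ⟩
      + (k + t) - + k              ≡⟨ [+m]-[+n]≡+[m∸n] (m≤m+n k t) ⟩
      + (k + t ∸ k)                ≡⟨ cong +_ (m+n∸m≡n k t) ⟩
      + t                          ∎

  module SaturatingRun {m : ℕ} (u : Vec Bool (suc m)) (v d q : ℕ) (v+d≡1+p : v + d ≡ suc p)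
                       (weight-u : weight u ≡ k + v)
                       (heads-false : ∀ i → i < q → head (window k p u i) ≡ false) where

    U : ℕ → Vec Bool (suc m)
    U = window k p u

    saturated-≤ᵇ : ∀ i → (v + i ℕ.⊓ d ≤ᵇ p) ≡ (i <ᵇ d)
    saturated-≤ᵇ i = begin
      (v + i ℕ.⊓ d ≤ᵇ p)              ≡⟨ 1+m≤ᵇ1+n≡m≤ᵇn (v + i ℕ.⊓ d) p ⟨
      (suc (v + i ℕ.⊓ d) ≤ᵇ suc p)    ≡⟨ cong₂ _≤ᵇ_ (sym (+-suc v (i ℕ.⊓ d))) (sym v+d≡1+p) ⟩
      (v + suc (i ℕ.⊓ d) ≤ᵇ v + d)    ≡⟨ +-cancelˡ-≤ᵇ v (suc (i ℕ.⊓ d)) d ⟩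
      (i ℕ.⊓ d <ᵇ d)                  ≡⟨ m⊓n<ᵇn≡m<ᵇn i d ⟩
      (i <ᵇ d)                        ∎

    run-weight : ∀ i → i ≤ q → weight (U i) ≡ k + (v + i ℕ.⊓ d)
    run-step : ∀ i → i < q → U (suc i) ≡ tail (U i) ∷ʳ (i <ᵇ d)

    run-weight zero    _   = trans weight-u (cong (λ t → k + t) (sym (+-identityʳ v)))
    run-weight (suc i) i<q = begin
      weight (U (suc i))                  ≡⟨ cong weight (run-step i i<q) ⟩
      weight (tail (U i) ∷ʳ (i <ᵇ d))     ≡⟨ weight-∷ʳ (tail (U i)) (i <ᵇ d) ⟩
      weight (tail (U i)) + bit (i <ᵇ d)  ≡⟨ cong (λ w → w + bit (i <ᵇ d)) (weight-tail (U i) (heads-false i i<q)) ⟩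
      weight (U i) + bit (i <ᵇ d)         ≡⟨ cong (λ w → w + bit (i <ᵇ d)) (run-weight i (<⇒≤ i<q)) ⟩
      k + (v + i ℕ.⊓ d) + bit (i <ᵇ d)    ≡⟨ trans (+-assoc k _ _) (cong (λ t → k + t) (+-assoc v _ _)) ⟩
      k + (v + (i ℕ.⊓ d + bit (i <ᵇ d)))  ≡⟨ cong (λ t → k + (v + t)) (m⊓n+bit[m<ᵇn]≡[1+m]⊓n i d) ⟩
      k + (v + suc i ℕ.⊓ d)               ∎

    run-step i i<q = begin
      step k p (U i)                      ≡⟨ step-head-false (U i) _ (heads-false i i<q) (run-weight i (<⇒≤ i<q)) ⟩
      tail (U i) ∷ʳ (v + i ℕ.⊓ d ≤ᵇ p)    ≡⟨ cong (tail (U i) ∷ʳ_) (saturated-≤ᵇ i) ⟩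
      tail (U i) ∷ʳ (i <ᵇ d)              ∎

  module ZeroRun {m : ℕ} (A : Vec Bool (suc m)) (A-in-range : WeightInRange (weight A)) (r q : ℕ)
                 (zeros : ∀ i → 1 ≤ i → i ≤ q → seqA k p A (r + i) ≡ 0) where

    open Windows A

    -- v is the paper's w_r and d = p + 1 - w_r, so that the paper's s is q ⊓ d.
    v : ℕ
    v = weight (W r) ∸ k

    d : ℕ
    d = suc p ∸ v

    weight-start : weight (W r) ≡ k + v
    weight-start = sym (m+[n∸m]≡n (proj₁ (window-preserves-range A-in-range r)))

    v≤1+p : v ≤ suc p
    v≤1+p = +-cancelˡ-≤ k v (suc p)
      (subst₂ _≤_ weight-start (trans (+-assoc k p 1) (cong (λ t → k + t) (+-comm p 1)))
              (proj₂ (window-preserves-range A-in-range r)))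

    heads-false : ∀ i → i < q → head (window k p (W r) i) ≡ false
    heads-false i i<q = bit≡0⇒false (begin
      bit (head (window k p (W r) i))  ≡⟨ cong (bit ∘ head) (window-+ r i) ⟨
      bit (head (W (r + i)))           ≡⟨ seqA-suc (r + i) ⟨
      a (suc (r + i))                  ≡⟨ cong a (+-suc r i) ⟨
      a (r + suc i)                    ≡⟨ zeros (suc i) (s≤s z≤n) i<q ⟩
      0                                ∎)

    open SaturatingRun (W r) v d q (m+[n∸m]≡n v≤1+p) weight-start heads-false

    wr-start : wr k p (suc m) A r ≡ + v
    wr-start = wr-window r v weight-start

    s≡q⊓d : + q ⊓ (+ (p + 1) - wr k p (suc m) A r) ≡ + (q ℕ.⊓ d)
    s≡q⊓d = cong (λ z → + q ⊓ z) (begin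
      + (p + 1) - wr k p (suc m) A r  ≡⟨ cong (λ w → + (p + 1) - w) wr-start ⟩
      + (p + 1) - + v                 ≡⟨ cong (λ t → + t - + v) (+-comm p 1) ⟩
      + suc p - + v                   ≡⟨ [+m]-[+n]≡+[m∸n] v≤1+p ⟩
      + d                             ∎)

    wr-run : ∀ i → i ≤ q → wr k p (suc m) A (r + i) ≡ + (v + i ℕ.⊓ d)
    wr-run i i≤q = wr-window (r + i) _ (trans (cong weight (window-+ r i)) (run-weight i i≤q))

    seqA-run : ∀ i → i < q → a (r + suc m + suc i) ≡ bit (i <ᵇ d)
    seqA-run i i<q = begin
      a (r + suc m + suc i)                 ≡⟨ cong a (+-assoc r (suc m) (suc i)) ⟩
      a (r + (suc m + suc i))               ≡⟨ cong (λ t → a (r + t)) (+-comm (suc m) (suc i)) ⟩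
      a (r + (suc i + suc m))               ≡⟨ cong a (+-assoc r (suc i) (suc m)) ⟨
      a (r + suc i + suc m)                 ≡⟨ seqA-+n (r + suc i) ⟩
      bit (get (W (r + suc i)) m)           ≡⟨ cong (λ w → bit (get w m)) (trans (window-+ r (suc i)) (run-step i i<q)) ⟩
      bit (get (tail (U i) ∷ʳ (i <ᵇ d)) m)  ≡⟨ cong bit (get-∷ʳ-last (tail (U i)) (i <ᵇ d)) ⟩
      bit (i <ᵇ d)                          ∎

    wr-rising : ∀ i → i ≤ q ℕ.⊓ d → wr k p (suc m) A (r + i) ≡ + (v + i)
    wr-rising i i≤s = trans (wr-run i (m≤n⊓o⇒m≤n q d i≤s))
                            (cong (λ t → + (v + t)) (m≤n⇒m⊓n≡m (m≤n⊓o⇒m≤o q d i≤s)))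

    wr-saturated : q ℕ.⊓ d < q → ∀ i → q ℕ.⊓ d ≤ i → i ≤ q → wr k p (suc m) A (r + i) ≡ + (p + 1)
    wr-saturated s<q i s≤i i≤q = begin
      wr k p (suc m) A (r + i)  ≡⟨ wr-run i i≤q ⟩
      + (v + i ℕ.⊓ d)           ≡⟨ cong (λ t → + (v + t)) (m≥n⇒m⊓n≡n (subst (_≤ i) (m⊓n<m⇒m⊓n≡n s<q) s≤i)) ⟩
      + (v + d)                 ≡⟨ cong +_ (trans (m+[n∸m]≡n v≤1+p) (+-comm 1 p)) ⟩
      + (p + 1)                 ∎

    seqA-rising : ∀ i → 1 ≤ i → i ≤ q ℕ.⊓ d → a (r + suc m + i) ≡ 1
    seqA-rising (suc i) _ i<s = trans (seqA-run i (m<n⊓o⇒m<n q d i<s)) (m<n⇒bit[m<ᵇn]≡1 (m<n⊓o⇒m<o q d i<s))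

    seqA-saturated : ∀ i → q ℕ.⊓ d < i → i ≤ q → a (r + suc m + i) ≡ 0
    seqA-saturated (suc i) s<1+i i<q = trans (seqA-run i i<q) (n≤m⇒bit[m<ᵇn]≡0 d≤i)
      where
      d≤i : d ≤ i
      d≤i = subst (_≤ i) (m⊓n<m⇒m⊓n≡n (<-≤-trans s<1+i i<q)) (s≤s⁻¹ s<1+i)

proposition42p3 : (k p n : ℕ) → k + p < n → (A : Vec Bool n) →
    k ≤ weight A → weight A ≤ k + p + 1 →
    (r q : ℕ) → 1 ≤ q →
    (∀ i → 1 ≤ i → i ≤ q → seqA k p A (r + i) ≡ 0) →
    let s = (+ q) ⊓ (+ (p + 1) - wr k p n A r) in
    ((∀ (i : ℕ) → + i ≤ℤ s → wr k p n A (r + i) ≡ wr k p n A r +ℤ + i)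
      × (∀ (i : ℕ) → 1 ≤ i → + i ≤ℤ s → seqA k p A (r + n + i) ≡ 1))
    × (s <ℤ + q →
        (∀ (i : ℕ) → s ≤ℤ + i → i ≤ q → wr k p n A (r + i) ≡ + (p + 1))
        × (∀ (i : ℕ) → s <ℤ + i → i ≤ q → seqA k p A (r + n + i) ≡ 0))
    × (wr k p n A (r + q) ≡ wr k p n A r +ℤ s
        × (∀ (i : ℕ) → 1 ≤ i → i ≤ q →
            (+ i ≤ℤ s → seqA k p A (r + n + i) ≡ 1)
            × (s <ℤ + i → seqA k p A (r + n + i) ≡ 0)))
proposition42p3 k p zero    ()
proposition42p3 k p (suc m) _ A lo hi r q _ zeros
  rewrite ZeroRun.s≡q⊓d k p A (lo , hi) r q zeros | ZeroRun.wr-start k p A (lo , hi) r q zeros =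
    ( (λ i i≤s → wr-rising i (drop‿+≤+ i≤s))
    , (λ i 1≤i i≤s → seqA-rising i 1≤i (drop‿+≤+ i≤s)) )
  , (λ s<q → (λ i s≤i i≤q → wr-saturated (drop‿+<+ s<q) i (drop‿+≤+ s≤i) i≤q)
           , (λ i s<i i≤q → seqA-saturated i (drop‿+<+ s<i) i≤q))
  , ( wr-run q ≤-refl
    , λ i 1≤i i≤q → (λ i≤s → seqA-rising i 1≤i (drop‿+≤+ i≤s))
                  , (λ s<i → seqA-saturated i (drop‿+<+ s<i) i≤q) )
  where open ZeroRun k p A (lo , hi) r q zeros
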